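{- Let $G=\Theta(s^m)$ be a uniform generalized theta graph (with $m\ge 2$). Then $\beta(G)\geq m-1$. Furthermore, if $W$ is a resolving set of $G$, then for $m-1$ distinct paths $P_i$, at least one internal vertex of each of these paths belongs to $W$.
   Context: Graphs are simple, connected, finite. A set $W\subseteq V(G)$ is resolving if for any distinct $u,v$ there is $w\in W$ with $d(u,w)\ne d(v,w)$; $\beta(G)$ is the minimum size of a resolving set. $\Theta(s^m)$ denotes the graph consisting of two vertices $c_1,c_2$ (centers) joined by $m$ internally disjoint paths $P_1,\dots,P_m$, each of length $s+1$ (with $s\ge1$ internal vertices). -}

module Defs where

open import Data.Nat using (ℕ; zero; suc; _≤_)
open import Data.Fin using (Fin; toℕ)
open import Data.Product using (Σ; _×_; ∃)
open import Data.Sum using (_⊎_)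
open import Data.List using (List; length)
open import Data.List.Membership.Propositional using (_∈_)
open import Relation.Binary.PropositionalEquality using (_≡_; _≢_)

-- Vertices of the uniform generalized theta graph Θ(s^m):
-- the two centers c₁, c₂ and the internal vertices  inner i j  of path P_i
-- (i : Fin m), listed in order j = 0, …, s-1 from c₁ towards c₂.
data ThetaV (m s : ℕ) : Set where
  c₁ c₂ : ThetaV m s
  inner : Fin m → Fin s → ThetaV m s

data Edge {m s : ℕ} : ThetaV m s → ThetaV m s → Set where
  first : ∀ i j → toℕ j ≡ 0 → Edge c₁ (inner i j)
  step  : ∀ i j k → suc (toℕ j) ≡ toℕ k → Edge (inner i j) (inner i k)
  last  : ∀ i j → suc (toℕ j) ≡ s → Edge (inner i j) c₂

Adj : {m s : ℕ} → ThetaV m s → ThetaV m s → Set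
Adj u v = Edge u v ⊎ Edge v u

data Walk {m s : ℕ} : ThetaV m s → ThetaV m s → ℕ → Set where
  nil  : ∀ {u} → Walk u u 0
  cons : ∀ {u v w n} → Adj u v → Walk v w n → Walk u w (suc n)

Dist : {m s : ℕ} → ThetaV m s → ThetaV m s → ℕ → Set
Dist u v k = Walk u v k × (∀ n → Walk u v n → k ≤ n)

Distinguishes : {m s : ℕ} → ThetaV m s → ThetaV m s → ThetaV m s → Set
Distinguishes w u v = ∀ k l → Dist u w k → Dist v w l → k ≢ l

Resolving : {m s : ℕ} → List (ThetaV m s) → Set
Resolving {m} {s} W =
  ∀ (u v : ThetaV m s) → u ≢ v → ∃ λ w → w ∈ W × Distinguishes w u v

-- Swapping two paths P_i and P_k of the theta graph is an automorphism, so a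
-- vertex w outside P_i ∪ P_k has the same distance to the first internal
-- vertex of P_i as to that of P_k. A resolving set must therefore contain an
-- internal vertex of all paths but at most one.
module Submission where

open import Defs
open import Data.Nat using (ℕ; zero; suc; _+_; _≤_; _∸_; _<_; _≤?_)
open import Data.Nat.Properties using (≰⇒>; suc-injective)
open import Data.Nat.Induction using (<-rec)
open import Data.Fin as Fin using (Fin; toℕ; fromℕ; inject₁; punchIn)
open import Data.Fin.Properties
  using (toℕ-inject₁; toℕ-fromℕ; any?; all?; ¬∀⟶∃¬; punchInᵢ≢i; punchIn-injective; injective⇒≤)
open import Data.Fin.Permutation using (Permutation; _⟨$⟩ʳ_; _⟨$⟩ˡ_; inverseˡ; transpose)
import Data.Fin.Permutation.Components as Components
open import Data.Product using (Σ; _×_; ∃; _,_; proj₁; proj₂)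
open import Data.Sum using (inj₁; inj₂)
open import Data.List using (List; length; tabulate)
open import Data.List.Properties using (length-tabulate)
open import Data.List.Membership.Propositional using (_∈_)
open import Data.List.Membership.Setoid.Properties using (index-injective)
open import Data.List.Relation.Unary.All using (All)
open import Data.List.Relation.Unary.All.Properties using (tabulate⁺)
open import Data.List.Relation.Unary.Unique.Propositional using (Unique)
import Data.List.Relation.Unary.Unique.Propositional.Properties as Unique
open import Function.Definitions using (Injective)
open import Relation.Nullary using (¬_; yes; no; contradiction)
open import Relation.Nullary.Decidable using (dec-true; dec-false; decidable-stable)
open import Level using (0ℓ)
open import Relation.Unary using (Pred; Decidable)
open import Relation.Binary.Definitions using (DecidableEquality)
open import Relation.Binary.PropositionalEquality
  using (_≡_; _≢_; refl; sym; trans; cong; subst; subst₂; setoid)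

-- Walk lengths are not decidable here, so a shortest walk exists only under ¬¬;
-- this suffices because it is only used to refute Distinguishes.
¬¬-least : (P : ℕ → Set) {n : ℕ} → P n → ¬ ¬ (∃ λ k → P k × (∀ n → P n → k ≤ n))
¬¬-least P {n} pn noLeast = <-rec (λ n → ¬ P n) noneBelow⇒¬P n pn
  where
  noneBelow⇒¬P : ∀ n → (∀ {k} → k < n → ¬ P k) → ¬ P n
  noneBelow⇒¬P n noneBelow pn = noLeast (n , pn , least)
    where
    least : ∀ k → P k → n ≤ k
    least k pk with n ≤? k
    ... | yes n≤k = n≤k
    ... | no n≰k = contradiction pk (noneBelow (≰⇒> n≰k))

all-but-one : ∀ {n} {P : Pred (Fin (suc n)) 0ℓ} → Decidable P →
              (∀ i j → ¬ P i → ¬ P j → i ≡ j) → ∃ λ i₀ → ∀ j → j ≢ i₀ → P j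
all-but-one P? unique with all? P?
... | yes all = Fin.zero , λ j _ → all j
... | no ¬all with ¬∀⟶∃¬ _ _ P? ¬all
...   | i₀ , ¬Pi₀ = i₀ , λ j j≢i₀ → decidable-stable (P? j) (λ ¬Pj → j≢i₀ (unique j i₀ ¬Pj ¬Pi₀))

injective-family⇒≤-length : ∀ {A : Set} {n} {xs : List A} {g : Fin n → A} →
                            Injective _≡_ _≡_ g → (∀ x → g x ∈ xs) → n ≤ length xs
injective-family⇒≤-length {A} g-inj g∈xs =
  injective⇒≤ λ {x} {y} eq → g-inj (index-injective (setoid A) (g∈xs x) (g∈xs y) eq)

transpose-source : ∀ {n} (i j : Fin n) → Components.transpose i j i ≡ j
transpose-source i j rewrite dec-true (i Fin.≟ i) refl = refl

transpose-fixes : ∀ {n} {i j a : Fin n} → a ≢ i → a ≢ j → Components.transpose i j a ≡ a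
transpose-fixes {i = i} {j} {a} a≢i a≢j
  rewrite dec-false (a Fin.≟ i) a≢i | dec-false (a Fin.≟ j) a≢j = refl

module _ {m s : ℕ} where

  _≟_ : DecidableEquality (ThetaV m s)
  c₁ ≟ c₁ = yes refl
  c₁ ≟ c₂ = no λ ()
  c₁ ≟ inner _ _ = no λ ()
  c₂ ≟ c₁ = no λ ()
  c₂ ≟ c₂ = yes refl
  c₂ ≟ inner _ _ = no λ ()
  inner _ _ ≟ c₁ = no λ ()
  inner _ _ ≟ c₂ = no λ ()
  inner a j ≟ inner b k with a Fin.≟ b | j Fin.≟ k
  ... | yes refl | yes refl = yes refl
  ... | no a≢b | _ = no λ { refl → a≢b refl }
  ... | yes _ | no j≢k = no λ { refl → j≢k refl }

  inner-injectiveˡ : ∀ {a b j k} → inner {m} {s} a j ≡ inner b k → a ≡ b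
  inner-injectiveˡ refl = refl

  Adj-sym : {u v : ThetaV m s} → Adj u v → Adj v u
  Adj-sym (inj₁ e) = inj₂ e
  Adj-sym (inj₂ e) = inj₁ e

  _++ʷ_ : ∀ {u v w : ThetaV m s} {k l} → Walk u v k → Walk v w l → Walk u w (k + l)
  nil ++ʷ q = q
  cons e p ++ʷ q = cons e (p ++ʷ q)

  snocʷ : ∀ {u v w : ThetaV m s} {n} → Walk u v n → Adj v w → Walk u w (suc n)
  snocʷ nil e = cons e nil
  snocʷ (cons e p) f = cons e (snocʷ p f)

  reverseʷ : ∀ {u v : ThetaV m s} {n} → Walk u v n → Walk v u n
  reverseʷ nil = nil
  reverseʷ (cons e p) = snocʷ (reverseʷ p) (Adj-sym e)

  inner→c₁ : ∀ (i : Fin m) (j : Fin s) → Walk (inner i j) c₁ (suc (toℕ j))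
  inner→c₁ i j = descend (toℕ j) j refl
    where
    descend : ∀ n (j : Fin s) → toℕ j ≡ n → Walk (inner i j) c₁ (suc n)
    descend zero Fin.zero _ = cons (inj₂ (first i Fin.zero refl)) nil
    descend (suc n) (Fin.suc j) j≡1+n =
      cons (inj₂ (step i (inject₁ j) (Fin.suc j) (cong suc (toℕ-inject₁ j))))
           (descend n (inject₁ j) (trans (toℕ-inject₁ j) (suc-injective j≡1+n)))

  relabel : (Fin m → Fin m) → ThetaV m s → ThetaV m s
  relabel f c₁ = c₁
  relabel f c₂ = c₂
  relabel f (inner a j) = inner (f a) j

  relabel-Edge : ∀ f {u v} → Edge u v → Edge (relabel f u) (relabel f v)
  relabel-Edge f (first a j j≡0) = first (f a) j j≡0
  relabel-Edge f (step a j k k≡1+j) = step (f a) j k k≡1+j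
  relabel-Edge f (last a j s≡1+j) = last (f a) j s≡1+j

  relabel-Walk : ∀ f {u v n} → Walk u v n → Walk (relabel f u) (relabel f v) n
  relabel-Walk f nil = nil
  relabel-Walk f (cons (inj₁ e) p) = cons (inj₁ (relabel-Edge f e)) (relabel-Walk f p)
  relabel-Walk f (cons (inj₂ e) p) = cons (inj₂ (relabel-Edge f e)) (relabel-Walk f p)

  relabel-inverse : ∀ (π : Permutation m m) v → relabel (π ⟨$⟩ˡ_) (relabel (π ⟨$⟩ʳ_) v) ≡ v
  relabel-inverse π c₁ = refl
  relabel-inverse π c₂ = refl
  relabel-inverse π (inner a j) = cong (λ b → inner b j) (inverseˡ π)

  relabel-Dist : ∀ (π : Permutation m m) {u v d} →
                 Dist u v d → Dist (relabel (π ⟨$⟩ʳ_) u) (relabel (π ⟨$⟩ʳ_) v) d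
  relabel-Dist π {u} {v} (walk , shortest) = relabel-Walk (π ⟨$⟩ʳ_) walk , λ n p →
    shortest n (subst₂ (λ x y → Walk x y n) (relabel-inverse π u) (relabel-inverse π v)
                       (relabel-Walk (π ⟨$⟩ˡ_) p))

  ¬Distinguishes-orbit : ∀ (π : Permutation m m) {u w} → ∃ (Walk u w) →
                         relabel (π ⟨$⟩ʳ_) w ≡ w → ¬ Distinguishes w u (relabel (π ⟨$⟩ʳ_) u)
  ¬Distinguishes-orbit π {u} {w} (_ , walk) πw≡w distinguishes =
    ¬¬-least (Walk u w) walk λ (d , dist) →
      distinguishes d d dist (subst (λ x → Dist _ x d) πw≡w (relabel-Dist π dist)) refl

module _ {m s : ℕ} where

  connected : (u v : ThetaV (suc m) (suc s)) → ∃ (Walk u v)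
  connected u v = _ , proj₂ (toC₁ u) ++ʷ reverseʷ (proj₂ (toC₁ v))
    where
    toC₁ : (v : ThetaV (suc m) (suc s)) → ∃ λ n → Walk v c₁ n
    toC₁ c₁ = _ , nil
    toC₁ c₂ = _ , cons (inj₂ (last Fin.zero (fromℕ s) (cong suc (toℕ-fromℕ s))))
                       (inner→c₁ Fin.zero (fromℕ s))
    toC₁ (inner i j) = _ , inner→c₁ i j

module _ {m s : ℕ} (W : List (ThetaV m s)) where

  Meets : Pred (Fin m) 0ℓ
  Meets i = ∃ λ j → inner i j ∈ W

  open import Data.List.Membership.DecPropositional (_≟_ {m} {s}) using (_∈?_)

  Meets? : Decidable Meets
  Meets? i = any? λ j → inner i j ∈? W

module _ {m s : ℕ} {W : List (ThetaV (suc m) (suc s))} (resolving : Resolving W) where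

  unmet-path-unique : ∀ i k → ¬ Meets W i → ¬ Meets W k → i ≡ k
  unmet-path-unique i k ¬Mi ¬Mk = decidable-stable (i Fin.≟ k) λ i≢k →
    let (w , w∈W , distinguishes) = resolving (inner i Fin.zero) (inner k Fin.zero)
                                              (λ eq → i≢k (inner-injectiveˡ eq))
    in ¬Distinguishes-orbit π (connected _ w) (fixes w w∈W)
         (subst (Distinguishes w _) (sym πu≡v) distinguishes)
    where
    π : Permutation (suc m) (suc m)
    π = transpose i k
    πu≡v : relabel (π ⟨$⟩ʳ_) (inner i Fin.zero) ≡ inner k Fin.zero
    πu≡v = cong (λ a → inner a Fin.zero) (transpose-source i k)
    fixes : ∀ w → w ∈ W → relabel (π ⟨$⟩ʳ_) w ≡ w
    fixes c₁ _ = refl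
    fixes c₂ _ = refl
    fixes (inner a j) a∈W = cong (λ b → inner b j) (transpose-fixes
      (λ a≡i → ¬Mi (j , subst (λ b → inner b j ∈ W) a≡i a∈W))
      (λ a≡k → ¬Mk (j , subst (λ b → inner b j ∈ W) a≡k a∈W)))

  all-paths-but-one-met : ∃ λ i₀ → ∀ i → i ≢ i₀ → Meets W i
  all-paths-but-one-met = all-but-one (Meets? W) unmet-path-unique

mainTheorem4 : (m s : ℕ) → 2 ≤ m → 1 ≤ s →
    ((W : List (ThetaV m s)) → Unique W → Resolving W → m ∸ 1 ≤ length W)
    ×
    ((W : List (ThetaV m s)) → Resolving W →
    Σ (List (Fin m)) λ I → Unique I × length I ≡ m ∸ 1 ×
    All (λ i → ∃ λ j → inner i j ∈ W) I)
mainTheorem4 (suc m) (suc s) _ _ = resolving⇒≤length , resolving⇒met-paths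
  where
  met-besides : ∀ {W} → Resolving W → ∃ λ i₀ → ∀ x → Meets W (punchIn i₀ x)
  met-besides resolving =
    let (i₀ , meets) = all-paths-but-one-met resolving
    in i₀ , λ x → meets (punchIn i₀ x) (punchInᵢ≢i i₀ x)

  resolving⇒≤length : (W : List (ThetaV (suc m) (suc s))) → Unique W → Resolving W → m ≤ length W
  resolving⇒≤length W _ resolving =
    let (i₀ , meets) = met-besides resolving
    in injective-family⇒≤-length {g = λ x → inner (punchIn i₀ x) (proj₁ (meets x))}
         (λ eq → punchIn-injective i₀ _ _ (inner-injectiveˡ eq)) (λ x → proj₂ (meets x))

  resolving⇒met-paths : (W : List (ThetaV (suc m) (suc s))) → Resolving W →
    Σ (List (Fin (suc m))) λ I → Unique I × length I ≡ m × All (Meets W) I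
  resolving⇒met-paths W resolving =
    let (i₀ , meets) = met-besides resolving
    in tabulate (punchIn i₀) , Unique.tabulate⁺ (punchIn-injective i₀ _ _) ,
       length-tabulate (punchIn i₀) , tabulate⁺ meets
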